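{- Let $G$ be a tree-path intersection graph with the rooting and order $\le$ described in the context. For any vertex $s\in G_H\cup G_V$, either $\min\Gamma\Gamma(s)<s$, or $s$ is the root of $T_H$ or of $T_V$ (i.e. $s\in\{h_{\mathrm{root}},v_{\mathrm{root}}\}$).
   Context: A tree-path intersection graph is a connected bipartite graph $G$ with disjoint parts $G_H$, $G_V$, together with a tree $T_H$ on vertex set $G_H$ and a tree $T_V$ on vertex set $G_V$, such that for every $h\in G_H$ the neighbourhood $\Gamma(h)$ of $h$ in $G$ is the vertex set of a path in $T_V$, and for every $v\in G_V$ the neighbourhood $\Gamma(v)$ is the vertex set of a path in $T_H$. Fix an edge $h_{\mathrm{root}}v_{\mathrm{root}}\in E(G)$ such that $v_{\mathrm{root}}$ is a leaf of $T_V$; root $T_H$ at $h_{\mathrm{root}}$ and $T_V$ at $v_{\mathrm{root}}$. For $s_1,s_2$ both in $G_H$ (resp. both in $G_V$), $s_1\le s_2$ iff $s_1$ lies on the path of $T_H$ (resp. $T_V$) from the root to $s_2$; vertices from different sides are incomparable; $s_1<s_2$ means $s_1\le s_2$, $s_1\ne s_2$. $\Gamma\Gamma(s):=\Gamma(\Gamma(s))=\bigcup_{t\in\Gamma(s)}\Gamma(t)$. For a set $S$ of vertices of one side, $\min S$ denotes its unique $\le$-minimal element; $\min\Gamma\Gamma(s)$ exists for every $s$. -}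

module Defs where

open import Data.Nat using (ℕ; _≥_)
open import Data.Fin using (Fin)
open import Data.Bool using (Bool; true; false)
open import Data.Sum using (_⊎_; inj₁; inj₂)
open import Data.Product using (Σ; ∃; _×_; _,_)
open import Data.Empty using (⊥)
open import Data.List using (List; []; _∷_; length)
open import Data.List.Membership.Propositional using (_∈_)
open import Data.List.Relation.Unary.Unique.Propositional using (Unique)
open import Relation.Binary.PropositionalEquality using (_≡_; _≢_)
open import Relation.Nullary using (¬_)

Edge : {V : Set} → (V → V → Bool) → V → V → Set
Edge E a b = E a b ≡ true

data Walk {V : Set} (E : V → V → Bool) : V → V → List V → Set where
  single : ∀ a → Walk E a a (a ∷ [])
  step   : ∀ {a b c p} → Edge E a b → Walk E b c p → Walk E a c (a ∷ p)

IsPath : {V : Set} → (V → V → Bool) → V → V → List V → Set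
IsPath E a b p = Walk E a b p × Unique p

IsPathVertexSet : {V : Set} → (V → V → Bool) → (V → Set) → Set
IsPathVertexSet {V} E S =
  Σ V λ a → Σ V λ b → Σ (List V) λ p →
    IsPath E a b p × (∀ x → (S x → x ∈ p) × (x ∈ p → S x))

record IsSimpleGraph {V : Set} (E : V → V → Bool) : Set where
  field
    symmetric   : ∀ a b → E a b ≡ E b a
    irreflexive : ∀ a → E a a ≡ false

Connected : {V : Set} → (V → V → Bool) → Set
Connected {V} E = ∀ a b → Σ (List V) λ p → IsPath E a b p

Acyclic : {V : Set} → (V → V → Bool) → Set
Acyclic {V} E = ∀ a b (p : List V) → IsPath E a b p → length p ≥ 3 → ¬ Edge E b a

record IsTree {V : Set} (E : V → V → Bool) : Set where
  field
    simple    : IsSimpleGraph E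
    connected : Connected E
    acyclic   : Acyclic E

Leaf : {V : Set} → (V → V → Bool) → V → Set
Leaf E v = ∀ a b → Edge E v a → Edge E v b → a ≡ b

-- Vertex set of G: disjoint union of the parts G_H = Fin nH and G_V = Fin nV.
Vtx : ℕ → ℕ → Set
Vtx nH nV = Fin nH ⊎ Fin nV

bipEdge : {nH nV : ℕ} → (Fin nH → Fin nV → Bool) → Vtx nH nV → Vtx nH nV → Bool
bipEdge adj (inj₁ h) (inj₂ v) = adj h v
bipEdge adj (inj₂ v) (inj₁ h) = adj h v
bipEdge adj (inj₁ _) (inj₁ _) = false
bipEdge adj (inj₂ _) (inj₂ _) = false

record TreePathIntersectionGraph (nH nV : ℕ) : Set where
  field
    adj : Fin nH → Fin nV → Bool
    TH  : Fin nH → Fin nH → Bool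
    TV  : Fin nV → Fin nV → Bool
    G-connected : Connected (bipEdge adj)
    TH-tree : IsTree TH
    TV-tree : IsTree TV
    nbhdH-path : ∀ h → IsPathVertexSet TV (λ v → adj h v ≡ true)
    nbhdV-path : ∀ v → IsPathVertexSet TH (λ h → adj h v ≡ true)

module _ {nH nV : ℕ} (G : TreePathIntersectionGraph nH nV)
         (hroot : Fin nH) (vroot : Fin nV) where
  open TreePathIntersectionGraph G

  OnRootPath : {V : Set} → (V → V → Bool) → V → V → V → Set
  OnRootPath {V} E r s₁ s₂ = Σ (List V) λ p → IsPath E r s₂ p × s₁ ∈ p

  _≼_ : Vtx nH nV → Vtx nH nV → Set
  inj₁ a ≼ inj₁ b = OnRootPath TH hroot a b
  inj₂ a ≼ inj₂ b = OnRootPath TV vroot a b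
  inj₁ _ ≼ inj₂ _ = ⊥
  inj₂ _ ≼ inj₁ _ = ⊥

  _≺_ : Vtx nH nV → Vtx nH nV → Set
  s₁ ≺ s₂ = s₁ ≼ s₂ × s₁ ≢ s₂

  Γ : Vtx nH nV → Vtx nH nV → Set
  Γ s t = Edge (bipEdge adj) s t

  ΓΓ : Vtx nH nV → Vtx nH nV → Set
  ΓΓ s u = Σ (Vtx nH nV) λ t → Γ s t × Γ t u

  IsMin : (Vtx nH nV → Set) → Vtx nH nV → Set
  IsMin S m = S m × (∀ x → S x → m ≼ x)

{-# OPTIONS --safe #-}
-- Since s ∈ ΓΓ(s), min ΓΓ(s) ≤ s; suppose min ΓΓ(s) = s with s ∈ G_H (G_V is symmetric).
-- Then the descendants of s in T_H (those y with s on the root path of y) are closed under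
-- sharing a neighbour: if x is a descendant and x, y ∈ Γ(b), either s ∈ Γ(b), so
-- y ∈ ΓΓ(s) lies above the minimum s, or Γ(b) is a path of T_H avoiding s, and in a tree a
-- path avoiding s cannot leave the subtree below s.  As G is connected, h_root is reached
-- from s by such steps, so s lies on the root path of h_root, i.e. s = h_root.
module Submission where

open import Defs
open import Data.Nat using (ℕ; _≥_; s≤s; z≤n)
open import Data.Fin using (Fin)
import Data.Fin.Properties as Fin
open import Data.Bool using (Bool; true; false)
open import Data.Sum using (_⊎_; inj₁; inj₂; [_,_]′)
import Data.Sum.Properties as Sum
open import Data.Product using (Σ; _×_; _,_; proj₁; proj₂)
open import Data.Empty using (⊥; ⊥-elim)
open import Data.List using (List; []; _∷_; _++_; length)
open import Data.List.Relation.Unary.Any using (here; there)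
open import Data.List.Relation.Unary.All as All using (All)
open import Data.List.Relation.Unary.All.Properties using (All¬⇒¬Any; ¬Any⇒All¬)
open import Data.List.Relation.Unary.AllPairs using ([]; _∷_)
open import Data.List.Relation.Unary.Unique.Propositional using (Unique)
open import Data.List.Membership.Propositional using (_∈_; _∉_)
open import Data.List.Membership.Propositional.Properties using (∈-++⁻)
import Data.List.Membership.DecPropositional as DecMembership
open import Data.List.Relation.Binary.Subset.Propositional using (_⊆_)
open import Data.List.Relation.Binary.Subset.Propositional.Properties
  using (⊆-refl; ⊆-trans; xs⊆x∷xs; ∷⁺ʳ; ∈-∷⁺ʳ)
open import Relation.Binary.Construct.Closure.ReflexiveTransitive using (Star; ε; _◅_)
open import Relation.Binary.Definitions using (DecidableEquality)
open import Relation.Binary.PropositionalEquality using (_≡_; _≢_; refl; sym; trans; cong)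
open import Relation.Nullary using (yes; no)

++-⊆ : ∀ {A : Set} {xs ys zs : List A} → xs ⊆ zs → ys ⊆ zs → xs ++ ys ⊆ zs
++-⊆ {xs = xs} xs⊆zs ys⊆zs k = [ xs⊆zs , ys⊆zs ]′ (∈-++⁻ xs k)

module Walks {V : Set} (E : V → V → Bool) where

  head∈ : ∀ {a b p} → Walk E a b p → a ∈ p
  head∈ (single a) = here refl
  head∈ (step _ _) = here refl

  last∈ : ∀ {a b p} → Walk E a b p → b ∈ p
  last∈ (single a) = here refl
  last∈ (step _ w) = there (last∈ w)

  walk-++ : ∀ {a b c p q} → Walk E a b p → Walk E b c q →
            Σ (List V) λ r → Walk E a c r × r ⊆ p ++ q
  walk-++ (single a) w = _ , w , there
  walk-++ (step e w₁) w₂ with walk-++ w₁ w₂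
  ... | r , w , r⊆ = _ , step e w , ∷⁺ʳ _ r⊆

  path-suffix : ∀ {a b x q} → IsPath E a b q → x ∈ q →
                Σ (List V) λ q′ → IsPath E x b q′ × q′ ⊆ q
  path-suffix P@(single _ , _) (here refl) = _ , P , ⊆-refl
  path-suffix P@(step _ _ , _) (here refl) = _ , P , ⊆-refl
  path-suffix (step _ w , _ ∷ u) (there k) with path-suffix (w , u) k
  ... | q′ , P′ , q′⊆ = q′ , P′ , ⊆-trans q′⊆ (xs⊆x∷xs _ _)

  walk-length≥2 : ∀ {a b p} → Walk E a b p → a ≢ b → length p ≥ 2
  walk-length≥2 (single _) a≢b = ⊥-elim (a≢b refl)
  walk-length≥2 (step _ (single _)) _ = s≤s (s≤s z≤n)
  walk-length≥2 (step _ (step _ _)) _ = s≤s (s≤s z≤n)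

  module _ (_≟_ : DecidableEquality V) where
    open DecMembership _≟_ using (_∈?_)

    loop-erase : ∀ {a b p} → Walk E a b p → Σ (List V) λ q → IsPath E a b q × q ⊆ p
    loop-erase (single a) = _ , (single a , All.[] ∷ []) , ⊆-refl
    loop-erase (step {a} e w) with loop-erase w
    ... | q , P@(w′ , u) , q⊆ with a ∈? q
    ... | yes a∈q with path-suffix P a∈q
    ...   | q′ , P′ , q′⊆ = q′ , P′ , ⊆-trans (⊆-trans q′⊆ q⊆) (xs⊆x∷xs _ _)
    loop-erase (step {a} e w) | q , (w′ , u) , q⊆ | no a∉q =
      a ∷ q , (step e w′ , ¬Any⇒All¬ q a∉q ∷ u) , ∷⁺ʳ a q⊆

module SymmetricWalks {V : Set} {E : V → V → Bool} (E-sym : ∀ a b → E a b ≡ E b a) where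
  open Walks E

  edge-sym : ∀ {a b} → Edge E a b → Edge E b a
  edge-sym {a} {b} e = trans (E-sym b a) e

  walk-reverse : ∀ {a b p} → Walk E a b p → Σ (List V) λ r → Walk E b a r × r ⊆ p
  walk-reverse (single a) = _ , single a , ⊆-refl
  walk-reverse (step {a} e w) with walk-reverse w
  ... | r , w′ , r⊆ with walk-++ w′ (step (edge-sym e) (single a))
  ...   | r′ , w″ , r′⊆ = r′ , w″ , ⊆-trans r′⊆ (++-⊆ (⊆-trans r⊆ (xs⊆x∷xs _ a)) last-two)
    where
    last-two : _ ∷ a ∷ [] ⊆ a ∷ _
    last-two = ∈-∷⁺ʳ (there (head∈ w)) (∈-∷⁺ʳ (here refl) λ ())

  walk-within-path : ∀ {a b q x y} → IsPath E a b q → x ∈ q → y ∈ q →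
                     Σ (List V) λ r → Walk E x y r × r ⊆ q
  walk-within-path P x∈q y∈q with path-suffix P x∈q | path-suffix P y∈q
  ... | _ , (x→b , _) , ⊆₁ | _ , (y→b , _) , ⊆₂ with walk-reverse y→b
  ...   | _ , b→y , ⊆₃ with walk-++ x→b b→y
  ...     | r , x→y , ⊆₄ = r , x→y , ⊆-trans ⊆₄ (++-⊆ ⊆₁ (⊆-trans ⊆₃ ⊆₂))

module TreePaths {V : Set} (_≟_ : DecidableEquality V) {E : V → V → Bool} (T : IsTree E) where
  open Walks E
  open SymmetricWalks (IsSimpleGraph.symmetric (IsTree.simple T))
  open DecMembership _≟_ using (_∈?_)

  record Interior (a b c : V) : Set where
    field
      pred succ   : V
      pred≢succ   : pred ≢ succ
      pred-edge   : Edge E pred c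
      succ-edge   : Edge E c succ
      before      : List V
      before-walk : Walk E a pred before
      c∉before    : c ∉ before
      after       : List V
      after-walk  : Walk E succ b after
      c∉after     : c ∉ after

  interior-first : ∀ {a b c q} → Edge E a c → Walk E c b q → Unique q → All (a ≢_) q →
                   c ≢ a → c ≢ b → Interior a b c
  interior-first _ (single _) _ _ _ c≢b = ⊥-elim (c≢b refl)
  interior-first {a} e (step e′ w) (c∉ ∷ _) a∉ c≢a _ = record
    { pred = a ; succ = _
    ; pred≢succ = All.lookup a∉ (there (head∈ w))
    ; pred-edge = e ; succ-edge = e′
    ; before = a ∷ [] ; before-walk = single a ; c∉before = λ { (here c≡a) → c≢a c≡a }
    ; after = _ ; after-walk = w ; c∉after = All¬⇒¬Any c∉
    }

  interior-cons : ∀ {a a′ b c} → Edge E a a′ → c ≢ a → Interior a′ b c → Interior a b c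
  interior-cons {a} e c≢a I = record
    { pred = pred ; succ = succ ; pred≢succ = pred≢succ
    ; pred-edge = pred-edge ; succ-edge = succ-edge
    ; before = a ∷ before ; before-walk = step e before-walk
    ; c∉before = λ { (here c≡a) → c≢a c≡a ; (there k) → c∉before k }
    ; after = after ; after-walk = after-walk ; c∉after = c∉after
    }
    where open Interior I

  interior : ∀ {a b c p} → IsPath E a b p → c ∈ p → c ≢ a → c ≢ b → Interior a b c
  interior (single _ , _) (here refl) c≢a _ = ⊥-elim (c≢a refl)
  interior (step _ _ , _) (here refl) c≢a _ = ⊥-elim (c≢a refl)
  interior {c = c} (step {b = a′} e w , a∉ ∷ u) (there k) c≢a c≢b with c ≟ a′
  ... | yes refl = interior-first e w u a∉ c≢a c≢b
  ... | no c≢a′ = interior-cons e c≢a (interior (w , u) k c≢a′ c≢b)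

  module _ {a b c : V} (I : Interior a b c) where
    open Interior I

    -- The detour pred → a → b → succ, loop-erased, would close a cycle through c.
    interior-unavoidable : ∀ {r} → Walk E a b r → c ∉ r → ⊥
    interior-unavoidable {r} W c∉r with walk-reverse before-walk | walk-reverse after-walk
    ... | _ , pred→a , ⊆₁ | _ , b→succ , ⊆₂ with walk-++ W b→succ
    ... | _ , a→succ , ⊆₃ with walk-++ pred→a a→succ
    ... | _ , pred→succ , ⊆₄ with loop-erase _≟_ pred→succ
    ... | Q , (Q-walk , Q-unique) , ⊆₅ =
      IsTree.acyclic T c succ (c ∷ Q)
        (step (edge-sym pred-edge) Q-walk , ¬Any⇒All¬ Q c∉Q ∷ Q-unique)
        (s≤s (walk-length≥2 Q-walk pred≢succ))
        (edge-sym succ-edge)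
      where
      c∉Q : c ∉ Q
      c∉Q k with ∈-++⁻ _ (⊆₄ (⊆₅ k))
      ... | inj₁ k₁ = c∉before (⊆₁ k₁)
      ... | inj₂ k₂ with ∈-++⁻ r (⊆₃ k₂)
      ...   | inj₁ k₃ = c∉r k₃
      ...   | inj₂ k₄ = c∉after (⊆₂ k₄)

  module Rooted (root : V) where

    Ancestor : V → V → Set
    Ancestor h y = Σ (List V) λ p → IsPath E root y p × h ∈ p

    ancestor-refl : ∀ y → Ancestor y y
    ancestor-refl y with IsTree.connected T root y
    ... | p , P@(w , _) = p , P , last∈ w

    ancestor-of-root : ∀ {h} → Ancestor h root → h ≡ root
    ancestor-of-root (_ , (single _ , _) , here refl) = refl
    ancestor-of-root (_ , (step _ w , root∉ ∷ _) , _) = ⊥-elim (All¬⇒¬Any root∉ (last∈ w))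

    -- A path avoiding h cannot leave the subtree below h, as h is interior to the root path.
    ancestor-along-path : ∀ {h x y a b q} → h ≢ root → Ancestor h x →
                          IsPath E a b q → x ∈ q → y ∈ q → h ∉ q → Ancestor h y
    ancestor-along-path {h} {x} {q = q} h≢root (p , P@(root→x , _) , h∈p) Q x∈q y∈q h∉q
      with walk-within-path Q x∈q y∈q
    ... | _ , x→y , ⊆₁ with walk-++ root→x x→y
    ... | _ , root→y , _ with loop-erase _≟_ root→y
    ... | R , R-path@(R-walk , _) , _ with h ∈? R
    ...   | yes h∈R = R , R-path , h∈R
    ...   | no h∉R with walk-reverse x→y
    ...     | _ , y→x , ⊆₂ with walk-++ R-walk y→x
    ...       | r , root→x′ , ⊆₃ =
      ⊥-elim (interior-unavoidable (interior P h∈p h≢root h≢x) root→x′ h∉r)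
      where
      h≢x : h ≢ x
      h≢x refl = h∉q x∈q
      h∉r : h ∉ r
      h∉r k = [ h∉R , (λ k′ → h∉q (⊆₁ (⊆₂ k′))) ]′ (∈-++⁻ R (⊆₃ k))

module SharedNeighbours {A B : Set} (_≟_ : DecidableEquality A) {E : A → A → Bool}
                        (T : IsTree E) (R : A → B → Bool)
                        (R-path : ∀ b → IsPathVertexSet E (λ a → R a b ≡ true))
                        (root : A) where
  open TreePaths _≟_ T
  open Rooted root

  SharedNeighbour : A → A → Set
  SharedNeighbour x y = Σ B λ b → R x b ≡ true × R y b ≡ true

  module _ {h : A} (h≢root : h ≢ root)
           (closed : ∀ {y} → SharedNeighbour h y → Ancestor h y) where

    ancestor-shared : ∀ {x y} → SharedNeighbour x y → Ancestor h x → Ancestor h y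
    ancestor-shared {x} {y} (b , xb , yb) h≤x with R h b in hb
    ... | true = closed (b , hb , yb)
    ... | false with R-path b
    ...   | _ , _ , q , Q , q≡Γb =
      ancestor-along-path h≢root h≤x Q (proj₁ (q≡Γb x) xb) (proj₁ (q≡Γb y) yb) h∉q
      where
      h∉q : h ∉ q
      h∉q k with trans (sym (proj₂ (q≡Γb h) k)) hb
      ... | ()

    ancestor-star : ∀ {x y} → Star SharedNeighbour x y → Ancestor h x → Ancestor h y
    ancestor-star ε h≤x = h≤x
    ancestor-star (s ◅ ss) h≤x = ancestor-star ss (ancestor-shared s h≤x)

  closed-under-sharing⇒root : ∀ {h} → Star SharedNeighbour h root →
                              (∀ {y} → SharedNeighbour h y → Ancestor h y) → h ≡ root
  closed-under-sharing⇒root {h} h⇝root closed with h ≟ root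
  ... | yes h≡root = h≡root
  ... | no h≢root =
    ancestor-of-root (ancestor-star h≢root closed h⇝root (ancestor-refl h))

module RootedGraph {nH nV : ℕ} (G : TreePathIntersectionGraph nH nV)
               (hroot : Fin nH) (vroot : Fin nV) where
  open TreePathIntersectionGraph G

  module H = SharedNeighbours Fin._≟_ TH-tree adj nbhdV-path hroot
  module V = SharedNeighbours Fin._≟_ TV-tree (λ v h → adj h v) nbhdH-path vroot

  walk⇒sharedᴴ : ∀ {x y p} → Walk (bipEdge adj) (inj₁ x) (inj₁ y) p → Star H.SharedNeighbour x y
  walk⇒sharedᴴ (single _) = ε
  walk⇒sharedᴴ (step {b = inj₁ _} () _)
  walk⇒sharedᴴ (step {b = inj₂ _} _ (step {b = inj₂ _} () _))
  walk⇒sharedᴴ (step {b = inj₂ b} xb (step {b = inj₁ _} x′b w)) = (b , xb , x′b) ◅ walk⇒sharedᴴ w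

  walk⇒sharedⱽ : ∀ {x y p} → Walk (bipEdge adj) (inj₂ x) (inj₂ y) p → Star V.SharedNeighbour x y
  walk⇒sharedⱽ (single _) = ε
  walk⇒sharedⱽ (step {b = inj₂ _} () _)
  walk⇒sharedⱽ (step {b = inj₁ _} _ (step {b = inj₁ _} () _))
  walk⇒sharedⱽ (step {b = inj₁ b} xb (step {b = inj₂ _} x′b w)) = (b , xb , x′b) ◅ walk⇒sharedⱽ w

  ∈ΓΓ-self : ∀ s → ΓΓ G hroot vroot s s
  ∈ΓΓ-self (inj₁ h) with G-connected (inj₁ h) (inj₂ vroot)
  ... | _ , (step {b = inj₂ v} hv _ , _) = inj₂ v , hv , hv
  ... | _ , (step {b = inj₁ _} () _ , _)
  ∈ΓΓ-self (inj₂ v) with G-connected (inj₂ v) (inj₁ hroot)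
  ... | _ , (step {b = inj₁ h} hv _ , _) = inj₁ h , hv , hv
  ... | _ , (step {b = inj₂ _} () _ , _)

  self-least-in-ΓΓ⇒root : ∀ s → (∀ x → ΓΓ G hroot vroot s x → _≼_ G hroot vroot s x) →
                          s ≡ inj₁ hroot ⊎ s ≡ inj₂ vroot
  self-least-in-ΓΓ⇒root (inj₁ h) s-least = inj₁ (cong inj₁
    (H.closed-under-sharing⇒root (walk⇒sharedᴴ (proj₁ (proj₂ (G-connected (inj₁ h) (inj₁ hroot)))))
      λ (b , hb , yb) → s-least (inj₁ _) (inj₂ b , hb , yb)))
  self-least-in-ΓΓ⇒root (inj₂ v) s-least = inj₂ (cong inj₂
    (V.closed-under-sharing⇒root (walk⇒sharedⱽ (proj₁ (proj₂ (G-connected (inj₂ v) (inj₂ vroot)))))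
      λ (b , vb , yb) → s-least (inj₂ _) (inj₁ b , vb , yb)))

lemma12 : ∀ {nH nV : ℕ} (G : TreePathIntersectionGraph nH nV)
            (hroot : Fin nH) (vroot : Fin nV) →
            TreePathIntersectionGraph.adj G hroot vroot ≡ true →
            Leaf (TreePathIntersectionGraph.TV G) vroot →
            ∀ (s m : Vtx nH nV) →
            IsMin G hroot vroot (ΓΓ G hroot vroot s) m →
            _≺_ G hroot vroot m s ⊎ (s ≡ inj₁ hroot ⊎ s ≡ inj₂ vroot)
lemma12 G hroot vroot _ _ s m (_ , m-least) with Sum.≡-dec Fin._≟_ Fin._≟_ m s
... | no m≢s = inj₁ (m-least s (RootedGraph.∈ΓΓ-self G hroot vroot s) , m≢s)
... | yes refl = inj₂ (RootedGraph.self-least-in-ΓΓ⇒root G hroot vroot s m-least)
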